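{- Let $G$ be a graph with maximum degree $\Delta$ and average degree $d\geq \Delta^{3/4}$. Then $G$ contains a $C_4$-free subgraph with average degree at least $d\cdot\Delta^{ -3/4}/4$.
   Context: Average degree of a graph is $2e/|V|$. A graph is $C_4$-free if it contains no cycle of length $4$. -}

module Defs where

open import Data.Nat using (ℕ; _+_; _≤_; _<_)
open import Data.Bool using (Bool; true; false; if_then_else_)
open import Data.Fin using (Fin; toℕ)
open import Data.List using (List; map; allFin)
open import Data.Nat.ListAction using (sum)
open import Data.Product using (Σ; ∃; _×_)
open import Relation.Binary.PropositionalEquality using (_≡_; _≢_)
open import Relation.Nullary using (¬_; Dec; does)
open import Function.Definitions using (Injective)
import Data.Nat as ℕ

record Graph (n : ℕ) : Set where
  field
    adj    : Fin n → Fin n → Bool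
    sym    : ∀ u v → adj u v ≡ adj v u
    irrefl : ∀ v → adj v v ≡ false
open Graph public

count : ∀ {n} → (Fin n → Bool) → ℕ
count {n} p = sum (map (λ i → if p i then 1 else 0) (allFin n))

degree : ∀ {n} → Graph n → Fin n → ℕ
degree G v = count (adj G v)

edges : ∀ {n} → Graph n → ℕ
edges {n} G = sum (map (λ i → count (λ j → if does (toℕ i ℕ.<? toℕ j) then adj G i j else false)) (allFin n))

IsMaxDegree : ∀ {n} → Graph n → ℕ → Set
IsMaxDegree G Δ = (∀ v → degree G v ≤ Δ) × ∃ (λ v → degree G v ≡ Δ)

IsSubgraph : ∀ {m n} → Graph m → Graph n → Set
IsSubgraph {m} {n} H G =
  Σ (Fin m → Fin n) λ f → Injective _≡_ _≡_ f ×
    (∀ u v → adj H u v ≡ true → adj G (f u) (f v) ≡ true)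

C4Free : ∀ {n} → Graph n → Set
C4Free {n} G = ∀ (a b c d : Fin n) →
  a ≢ b → a ≢ c → a ≢ d → b ≢ c → b ≢ d → c ≢ d →
  ¬ (adj G a b ≡ true × adj G b c ≡ true × adj G c d ≡ true × adj G d a ≡ true)

-- Scan the pairs of vertices once, keeping an edge uv of G whenever both endpoints still have
-- degree < k in the graph H built so far and H has no walk u-a-b-v. The result is a C4-free
-- spanning subgraph of maximum degree k in which every edge of G is blocked: it lies in H, has an
-- endpoint of H-degree k, or closes a walk of length three in H. Writing D_X for the degree sum
-- of X, there are at most D_H / k vertices of H-degree k, each meeting at most Δ edges of G, and
-- at most k²·D_H such walks; hence k·D_G ≤ (k + 2Δ + k³)·D_H. Any k with Δ^(1/4) ≤ k ≤ Δ^(1/3)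
-- gives k + 2Δ + k³ ≤ 4kΔ^(3/4).

module Submission where

open import Defs hiding (sym)
open import Data.Nat using (ℕ; zero; suc; _+_; _*_; _^_; _≤_; _<_; z≤n; s≤s; >-nonZero)
open import Data.Nat.Properties hiding (_≟_)
open import Data.Nat.Tactic.RingSolver using (solve-∀)
import Data.Nat.ListAction as List
open import Data.Bool using (Bool; true; false; if_then_else_; _∨_)
open import Data.Bool.Properties using (∨-zeroʳ) renaming (_≟_ to _≟ᴮ_)
open import Data.Fin using (Fin; zero; suc; toℕ; punchIn)
open import Data.Fin.Properties using (_≟_; any?; toℕ-injective; punchInᵢ≢i)
open import Data.List using ([]; _∷_; map; allFin; tabulate; foldl; cartesianProduct)
open import Data.List.Properties using (map-tabulate)
open import Data.List.Membership.Propositional using (_∈_)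
open import Data.List.Membership.Propositional.Properties using (∈-cartesianProduct⁺; ∈-allFin)
open import Data.List.Relation.Unary.Any using (here; there)
open import Data.Product using (Σ; ∃; ∃₂; _×_; _,_)
open import Data.Sum using (_⊎_; inj₁; inj₂)
open import Data.Empty using (⊥-elim)
open import Function using (_∘_; id; mk⇔)
open import Relation.Binary.Definitions using (tri<; tri≈; tri>)
open import Relation.Binary.PropositionalEquality
open import Relation.Nullary using (¬_; Dec; yes; no; does)
open import Relation.Nullary.Decidable
  using (dec-true; dec-false; does-⇔; _×-dec_; _⊎-dec_; _→-dec_; ¬?; toWitness)
open import Algebra.Properties.Semiring.Sum +-*-semiring
  using (sum; sum-syntax; sum-cong-≗; sum-remove; sum-replicate-zero; ∑-distrib-+; ∑-comm; *-distribˡ-sum)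

-- Finite sums over Fin n

𝟙 : Bool → ℕ
𝟙 b = if b then 1 else 0

𝟙≤1 : ∀ b → 𝟙 b ≤ 1
𝟙≤1 false = z≤n
𝟙≤1 true  = ≤-refl

𝟙-∨ : ∀ a b → 𝟙 (a ∨ b) ≤ 𝟙 a + 𝟙 b
𝟙-∨ false b = ≤-refl
𝟙-∨ true  b = s≤s z≤n

𝟙-mono : ∀ {a b} → (a ≡ true → b ≡ true) → 𝟙 a ≤ 𝟙 b
𝟙-mono {false} _ = z≤n
𝟙-mono {true}  h rewrite h refl = ≤-refl

∑-mono-≤ : ∀ {n} {f g : Fin n → ℕ} → (∀ i → f i ≤ g i) → ∑[ i < n ] f i ≤ ∑[ i < n ] g i
∑-mono-≤ {zero}  _ = z≤n
∑-mono-≤ {suc n} h = +-mono-≤ (h zero) (∑-mono-≤ (h ∘ suc))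

term≤∑ : ∀ {n} (f : Fin n → ℕ) (i : Fin n) → f i ≤ ∑[ j < n ] f j
term≤∑ {suc n} f i = ≤-trans (m≤m+n (f i) _) (≤-reflexive (sym (sum-remove f)))

∑-zero : ∀ {n} {f : Fin n → ℕ} → (∀ i → f i ≡ 0) → ∑[ i < n ] f i ≡ 0
∑-zero {n} h = trans (sum-cong-≗ h) (sum-replicate-zero n)

∑-supported : ∀ {n} {f : Fin n → ℕ} (i : Fin n) → (∀ j → j ≢ i → f j ≡ 0) → ∑[ j < n ] f j ≡ f i
∑-supported {suc n} {f} i h = begin
  ∑[ j < suc n ] f j              ≡⟨ sum-remove f ⟩
  f i + ∑[ j < n ] f (punchIn i j) ≡⟨ cong (f i +_) (∑-zero (λ j → h (punchIn i j) (punchInᵢ≢i i j))) ⟩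
  f i + 0                          ≡⟨ +-identityʳ (f i) ⟩
  f i                              ∎
  where open ≡-Reasoning

∑-𝟙-≤1 : ∀ {n} {A : Fin n → Set} (A? : ∀ i → Dec (A i)) (w : Fin n) →
         (∀ {i} → A i → i ≡ w) → ∑[ i < n ] 𝟙 (does (A? i)) ≤ 1
∑-𝟙-≤1 A? w only-w = begin
  ∑[ i < _ ] 𝟙 (does (A? i)) ≡⟨ ∑-supported w (λ i i≢w → cong 𝟙 (dec-false (A? i) (i≢w ∘ only-w))) ⟩
  𝟙 (does (A? w))            ≤⟨ 𝟙≤1 (does (A? w)) ⟩
  1                          ∎
  where open ≤-Reasoning

does-true⇒ : ∀ {A : Set} (a? : Dec A) → does a? ≡ true → A
does-true⇒ (yes a) _ = a

∑-distrib-+₄ : ∀ {n} (f g h w : Fin n → ℕ) →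
  ∑[ i < n ] (f i + g i + h i + w i) ≡ ∑[ i < n ] f i + ∑[ i < n ] g i + ∑[ i < n ] h i + ∑[ i < n ] w i
∑-distrib-+₄ {n} f g h w = begin
  ∑[ i < n ] (f i + g i + h i + w i)                     ≡⟨ ∑-distrib-+ (λ i → f i + g i + h i) w ⟩
  ∑[ i < n ] (f i + g i + h i) + ∑[ i < n ] w i
    ≡⟨ cong (λ s → s + ∑[ i < n ] w i) (∑-distrib-+ (λ i → f i + g i) h) ⟩
  ∑[ i < n ] (f i + g i) + ∑[ i < n ] h i + ∑[ i < n ] w i
    ≡⟨ cong (λ s → s + ∑[ i < n ] h i + ∑[ i < n ] w i) (∑-distrib-+ f g) ⟩
  ∑[ i < n ] f i + ∑[ i < n ] g i + ∑[ i < n ] h i + ∑[ i < n ] w i ∎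
  where open ≡-Reasoning

∑-comm-scale : ∀ {m n} (c : Fin m → ℕ) (g : Fin m → Fin n → ℕ) →
  ∑[ j < n ] ∑[ i < m ] (c i * g i j) ≡ ∑[ i < m ] (c i * ∑[ j < n ] g i j)
∑-comm-scale {m} {n} c g = begin
  ∑[ j < n ] ∑[ i < m ] (c i * g i j) ≡⟨ ∑-comm (λ j i → c i * g i j) ⟩
  ∑[ i < m ] ∑[ j < n ] (c i * g i j) ≡⟨ sum-cong-≗ (λ i → *-distribˡ-sum (c i) (g i)) ⟨
  ∑[ i < m ] (c i * ∑[ j < n ] g i j) ∎
  where open ≡-Reasoning

listSum-tabulate : ∀ {n} (f : Fin n → ℕ) → List.sum (tabulate f) ≡ ∑[ i < n ] f i
listSum-tabulate {zero}  f = refl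
listSum-tabulate {suc n} f = cong (f zero +_) (listSum-tabulate (f ∘ suc))

listSum-allFin : ∀ {n} (f : Fin n → ℕ) → List.sum (map f (allFin n)) ≡ ∑[ i < n ] f i
listSum-allFin f = trans (cong List.sum (map-tabulate id f)) (listSum-tabulate f)

count≡∑ : ∀ {n} (p : Fin n → Bool) → count p ≡ ∑[ i < n ] 𝟙 (p i)
count≡∑ p = listSum-allFin (λ i → 𝟙 (p i))

module _ {n : ℕ} where

  χ : Graph n → Fin n → Fin n → ℕ
  χ G u v = 𝟙 (adj G u v)

  χ-sym : ∀ (G : Graph n) u v → χ G u v ≡ χ G v u
  χ-sym G u v = cong 𝟙 (Graph.sym G u v)

  degree≡∑ : ∀ (G : Graph n) v → degree G v ≡ ∑[ w < n ] χ G v w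
  degree≡∑ G v = count≡∑ (adj G v)

  upper : Graph n → Fin n → Fin n → Bool
  upper G i j = if does (toℕ i <? toℕ j) then adj G i j else false

  edges≡∑ : ∀ (G : Graph n) → edges G ≡ ∑[ i < n ] ∑[ j < n ] 𝟙 (upper G i j)
  edges≡∑ G = trans (listSum-allFin (λ i → count (upper G i))) (sum-cong-≗ (λ i → count≡∑ (upper G i)))

  χ-split : ∀ (G : Graph n) i j → χ G i j ≡ 𝟙 (upper G i j) + 𝟙 (upper G j i)
  χ-split G i j with <-cmp (toℕ i) (toℕ j)
  ... | tri< i<j _ j≮i rewrite dec-true (toℕ i <? toℕ j) i<j | dec-false (toℕ j <? toℕ i) j≮i
    = sym (+-identityʳ (χ G i j))
  ... | tri> i≮j _ j<i rewrite dec-false (toℕ i <? toℕ j) i≮j | dec-true (toℕ j <? toℕ i) j<i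
    = χ-sym G i j
  ... | tri≈ i≮j i≡j _ rewrite toℕ-injective i≡j | dec-false (toℕ j <? toℕ j) i≮j
    = cong 𝟙 (irrefl G j)

  handshake : ∀ (G : Graph n) → ∑[ v < n ] degree G v ≡ 2 * edges G
  handshake G = begin
    ∑[ i < n ] degree G i                                      ≡⟨ sum-cong-≗ (degree≡∑ G) ⟩
    ∑[ i < n ] ∑[ j < n ] χ G i j                              ≡⟨ sum-cong-≗ (λ i → sum-cong-≗ (χ-split G i)) ⟩
    ∑[ i < n ] ∑[ j < n ] (E i j + E j i)
      ≡⟨ sum-cong-≗ (λ i → ∑-distrib-+ (E i) (λ j → E j i)) ⟩
    ∑[ i < n ] (∑[ j < n ] E i j + ∑[ j < n ] E j i)
      ≡⟨ ∑-distrib-+ (λ i → ∑[ j < n ] E i j) (λ i → ∑[ j < n ] E j i) ⟩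
    ∑[ i < n ] ∑[ j < n ] E i j + ∑[ i < n ] ∑[ j < n ] E j i
      ≡⟨ cong (∑[ i < n ] ∑[ j < n ] E i j +_) (∑-comm (λ i j → E j i)) ⟩
    ∑[ i < n ] ∑[ j < n ] E i j + ∑[ j < n ] ∑[ i < n ] E j i
      ≡⟨ cong₂ _+_ (edges≡∑ G) (edges≡∑ G) ⟨
    edges G + edges G                                          ≡⟨ cong (edges G +_) (+-identityʳ (edges G)) ⟨
    2 * edges G                                                ∎
    where
    open ≡-Reasoning
    E : Fin n → Fin n → ℕ
    E i j = 𝟙 (upper G i j)

edges≡0 : ∀ {n} (G : Graph n) → (∀ v → degree G v ≤ 0) → edges G ≡ 0
edges≡0 G degree≤0 =
  m+n≡0⇒m≡0 (edges G) (trans (sym (handshake G)) (∑-zero (λ v → n≤0⇒n≡0 (degree≤0 v))))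

module _ {n : ℕ} where

  record _⊆_ (H G : Graph n) : Set where
    constructor mk⊆
    field ⊆-adj : ∀ u v → adj H u v ≡ true → adj G u v ≡ true
  open _⊆_ public

  ⊆-refl : ∀ {G : Graph n} → G ⊆ G
  ⊆-refl = mk⊆ λ _ _ → id

  ⊆-trans : ∀ {F G H : Graph n} → F ⊆ G → G ⊆ H → F ⊆ H
  ⊆-trans F⊆G G⊆H = mk⊆ λ u v → ⊆-adj G⊆H u v ∘ ⊆-adj F⊆G u v

  degree-mono : ∀ {H G : Graph n} → H ⊆ G → ∀ v → degree H v ≤ degree G v
  degree-mono {H} {G} H⊆G v = begin
    degree H v            ≡⟨ degree≡∑ H v ⟩
    ∑[ w < n ] χ H v w    ≤⟨ ∑-mono-≤ (λ w → 𝟙-mono (⊆-adj H⊆G v w)) ⟩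
    ∑[ w < n ] χ G v w    ≡⟨ degree≡∑ G v ⟨
    degree G v            ∎
    where open ≤-Reasoning

  ⊆⇒IsSubgraph : ∀ {H G : Graph n} → H ⊆ G → IsSubgraph H G
  ⊆⇒IsSubgraph H⊆G = id , id , ⊆-adj H⊆G

  Walk₃ : Graph n → Fin n → Fin n → Set
  Walk₃ H u v = ∃₂ λ a b → adj H u a ≡ true × adj H a b ≡ true × adj H b v ≡ true

  walk₃? : ∀ H u v → Dec (Walk₃ H u v)
  walk₃? H u v = any? λ a → any? λ b →
    (adj H u a ≟ᴮ true) ×-dec (adj H a b ≟ᴮ true) ×-dec (adj H b v ≟ᴮ true)

  walk₃-reverse : ∀ {H u v} → Walk₃ H u v → Walk₃ H v u
  walk₃-reverse {H} (a , b , ua , ab , bv) =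
    b , a , trans (Graph.sym H _ b) bv , trans (Graph.sym H b a) ab , trans (Graph.sym H a _) ua

  walk₃-mono : ∀ {H G} → H ⊆ G → ∀ {u v} → Walk₃ H u v → Walk₃ G u v
  walk₃-mono H⊆G (a , b , ua , ab , bv) = a , b , ⊆-adj H⊆G _ a ua , ⊆-adj H⊆G a b ab , ⊆-adj H⊆G b _ bv

emptyGraph : ∀ {n} → Graph n
emptyGraph = record { adj = λ _ _ → false ; sym = λ _ _ → refl ; irrefl = λ _ → refl }

emptyGraph-C4Free : ∀ {n} → C4Free (emptyGraph {n})
emptyGraph-C4Free _ _ _ _ _ _ _ _ _ _ (() , _)

emptyGraph-⊆ : ∀ {n} (G : Graph n) → emptyGraph ⊆ G
emptyGraph-⊆ G = mk⊆ λ _ _ ()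

emptyGraph-degree : ∀ {n} (v : Fin n) → degree emptyGraph v ≡ 0
emptyGraph-degree v = trans (degree≡∑ emptyGraph v) (∑-zero {f = χ emptyGraph v} λ _ → refl)

adj⇒≢ : ∀ {n} (G : Graph n) {u v} → adj G u v ≡ true → u ≢ v
adj⇒≢ G {u} uv refl with () ← trans (sym uv) (irrefl G u)

-- Adding an edge

module AddEdge {n : ℕ} (H : Graph n) {u v : Fin n} (u≢v : u ≢ v) where

  Joins : Fin n → Fin n → Set
  Joins x y = (x ≡ u × y ≡ v) ⊎ (x ≡ v × y ≡ u)

  joins? : ∀ x y → Dec (Joins x y)
  joins? x y = (x ≟ u ×-dec y ≟ v) ⊎-dec (x ≟ v ×-dec y ≟ u)

  joins-sym : ∀ {x y} → Joins x y → Joins y x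
  joins-sym (inj₁ (x≡u , y≡v)) = inj₂ (y≡v , x≡u)
  joins-sym (inj₂ (x≡v , y≡u)) = inj₁ (y≡u , x≡v)

  joins-irrefl : ∀ {x} → ¬ Joins x x
  joins-irrefl (inj₁ (x≡u , x≡v)) = u≢v (trans (sym x≡u) x≡v)
  joins-irrefl (inj₂ (x≡v , x≡u)) = u≢v (trans (sym x≡u) x≡v)

  H⁺ : Graph n
  H⁺ = record
    { adj    = λ x y → adj H x y ∨ does (joins? x y)
    ; sym    = λ x y → cong₂ _∨_ (Graph.sym H x y) (does-⇔ (mk⇔ joins-sym joins-sym) (joins? x y) (joins? y x))
    ; irrefl = λ x → cong₂ _∨_ (irrefl H x) (dec-false (joins? x x) joins-irrefl)
    }

  H⊆H⁺ : H ⊆ H⁺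
  H⊆H⁺ = mk⊆ λ x y xy → cong (_∨ does (joins? x y)) xy

  adj-H⁺-uv : adj H⁺ u v ≡ true
  adj-H⁺-uv rewrite dec-true (joins? u v) (inj₁ (refl , refl)) = ∨-zeroʳ (adj H u v)

  adj-H⁺⁻ : ∀ x y → adj H⁺ x y ≡ true → adj H x y ≡ true ⊎ Joins x y
  adj-H⁺⁻ x y xy with adj H x y
  ... | true  = inj₁ refl
  ... | false = inj₂ (does-true⇒ (joins? x y) xy)

  newDegree : Fin n → ℕ
  newDegree x = ∑[ y < n ] 𝟙 (does (joins? x y))

  newDegree≤1 : ∀ x → newDegree x ≤ 1
  newDegree≤1 x = by-cases (x ≟ u)
    where
    by-cases : Dec (x ≡ u) → newDegree x ≤ 1
    by-cases (yes x≡u) = ∑-𝟙-≤1 (joins? x) v λ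
      { (inj₁ (_ , y≡v)) → y≡v ; (inj₂ (x≡v , _)) → ⊥-elim (u≢v (trans (sym x≡u) x≡v)) }
    by-cases (no x≢u)  = ∑-𝟙-≤1 (joins? x) u λ
      { (inj₁ (x≡u , _)) → ⊥-elim (x≢u x≡u) ; (inj₂ (_ , y≡u)) → y≡u }

  degree-H⁺ : ∀ x → degree H⁺ x ≤ degree H x + newDegree x
  degree-H⁺ x = begin
    degree H⁺ x                                  ≡⟨ degree≡∑ H⁺ x ⟩
    ∑[ y < n ] 𝟙 (adj H x y ∨ does (joins? x y)) ≤⟨ ∑-mono-≤ (λ y → 𝟙-∨ (adj H x y) _) ⟩
    ∑[ y < n ] (χ H x y + 𝟙 (does (joins? x y)))
      ≡⟨ ∑-distrib-+ (χ H x) (λ y → 𝟙 (does (joins? x y))) ⟩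
    ∑[ y < n ] χ H x y + newDegree x             ≡⟨ cong (_+ newDegree x) (degree≡∑ H x) ⟨
    degree H x + newDegree x                     ∎
    where open ≤-Reasoning

  degree-H⁺-≤ : ∀ x → degree H⁺ x ≤ suc (degree H x)
  degree-H⁺-≤ x = begin
    degree H⁺ x              ≤⟨ degree-H⁺ x ⟩
    degree H x + newDegree x ≤⟨ +-monoʳ-≤ (degree H x) (newDegree≤1 x) ⟩
    degree H x + 1           ≡⟨ +-comm (degree H x) 1 ⟩
    suc (degree H x)         ∎
    where open ≤-Reasoning

  degree-H⁺-other : ∀ x → x ≢ u → x ≢ v → degree H⁺ x ≤ degree H x
  degree-H⁺-other x x≢u x≢v = begin
    degree H⁺ x              ≤⟨ degree-H⁺ x ⟩
    degree H x + newDegree x ≡⟨ cong (degree H x +_) none ⟩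
    degree H x + 0           ≡⟨ +-identityʳ (degree H x) ⟩
    degree H x               ∎
    where
    open ≤-Reasoning
    none : newDegree x ≡ 0
    none = ∑-zero λ y → cong 𝟙 (dec-false (joins? x y)
      λ { (inj₁ (x≡u , _)) → x≢u x≡u ; (inj₂ (x≡v , _)) → x≢v x≡v })

  Endpoint : Fin n → Set
  Endpoint x = x ≡ u ⊎ x ≡ v

  source-endpoint : ∀ {x y} → Joins x y → Endpoint x
  source-endpoint (inj₁ (x≡u , _)) = inj₁ x≡u
  source-endpoint (inj₂ (x≡v , _)) = inj₂ x≡v

  target-endpoint : ∀ {x y} → Joins x y → Endpoint y
  target-endpoint (inj₁ (_ , y≡v)) = inj₂ y≡v
  target-endpoint (inj₂ (_ , y≡u)) = inj₁ y≡u

  no-third-endpoint : ∀ {a b z} → Joins a b → a ≢ z → b ≢ z → ¬ Endpoint z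
  no-third-endpoint (inj₁ (a≡u , _))   a≢z _   (inj₁ z≡u) = a≢z (trans a≡u (sym z≡u))
  no-third-endpoint (inj₁ (_   , b≡v)) _   b≢z (inj₂ z≡v) = b≢z (trans b≡v (sym z≡v))
  no-third-endpoint (inj₂ (_   , b≡u)) _   b≢z (inj₁ z≡u) = b≢z (trans b≡u (sym z≡u))
  no-third-endpoint (inj₂ (a≡v , _))   a≢z _   (inj₂ z≡v) = a≢z (trans a≡v (sym z≡v))

  closing-walk : ∀ {a b c d} → Joins a b →
                 adj H b c ≡ true → adj H c d ≡ true → adj H d a ≡ true → Walk₃ H u v
  closing-walk {c = c} {d} (inj₁ (refl , refl)) bc cd da = walk₃-reverse {H = H} (c , d , bc , cd , da)
  closing-walk {c = c} {d} (inj₂ (refl , refl)) bc cd da = c , d , bc , cd , da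

  -- A second new edge would put a third vertex of the cycle into {u, v}; otherwise the three
  -- old edges form a walk between u and v.
  cycle-through-new-edge : ∀ {a b c d} → a ≢ c → a ≢ d → b ≢ c → b ≢ d → Joins a b →
    adj H⁺ b c ≡ true → adj H⁺ c d ≡ true → adj H⁺ d a ≡ true → Walk₃ H u v
  cycle-through-new-edge a≢c a≢d b≢c b≢d ab bc cd da
    with adj-H⁺⁻ _ _ bc | adj-H⁺⁻ _ _ cd | adj-H⁺⁻ _ _ da
  ... | inj₂ bc′ | _        | _        = ⊥-elim (no-third-endpoint ab a≢c b≢c (target-endpoint bc′))
  ... | inj₁ _   | inj₂ cd′ | _        = ⊥-elim (no-third-endpoint ab a≢c b≢c (source-endpoint cd′))
  ... | inj₁ _   | inj₁ _   | inj₂ da′ = ⊥-elim (no-third-endpoint ab a≢d b≢d (source-endpoint da′))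
  ... | inj₁ bc′ | inj₁ cd′ | inj₁ da′ = closing-walk ab bc′ cd′ da′

  C4Free-H⁺ : C4Free H → ¬ Walk₃ H u v → C4Free H⁺
  C4Free-H⁺ c4 no-walk a b c d a≢b a≢c a≢d b≢c b≢d c≢d (ab , bc , cd , da)
    with adj-H⁺⁻ a b ab | adj-H⁺⁻ b c bc | adj-H⁺⁻ c d cd | adj-H⁺⁻ d a da
  ... | inj₂ ab′ | _        | _        | _        =
    no-walk (cycle-through-new-edge a≢c a≢d b≢c b≢d ab′ bc cd da)
  ... | inj₁ _   | inj₂ bc′ | _        | _        =
    no-walk (cycle-through-new-edge b≢d (≢-sym a≢b) c≢d (≢-sym a≢c) bc′ cd da ab)
  ... | inj₁ _   | inj₁ _   | inj₂ cd′ | _        =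
    no-walk (cycle-through-new-edge (≢-sym a≢c) (≢-sym b≢c) (≢-sym a≢d) (≢-sym b≢d) cd′ da ab bc)
  ... | inj₁ _   | inj₁ _   | inj₁ _   | inj₂ da′ =
    no-walk (cycle-through-new-edge (≢-sym b≢d) (≢-sym c≢d) a≢b a≢c da′ ab bc cd)
  ... | inj₁ ab′ | inj₁ bc′ | inj₁ cd′ | inj₁ da′ =
    c4 a b c d a≢b a≢c a≢d b≢c b≢d c≢d (ab′ , bc′ , cd′ , da′)

-- The greedy subgraph

module _ {n : ℕ} (k : ℕ) where

  Blocked : Graph n → Fin n → Fin n → Set
  Blocked H u v = adj H u v ≡ true ⊎ k ≤ degree H u ⊎ k ≤ degree H v ⊎ Walk₃ H u v

  blocked-mono : ∀ {H H′} → H ⊆ H′ → ∀ {u v} → Blocked H u v → Blocked H′ u v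
  blocked-mono H⊆H′ {u} {v} (inj₁ uv)                = inj₁ (⊆-adj H⊆H′ u v uv)
  blocked-mono H⊆H′ {u} {v} (inj₂ (inj₁ k≤u))        = inj₂ (inj₁ (≤-trans k≤u (degree-mono H⊆H′ u)))
  blocked-mono H⊆H′ {u} {v} (inj₂ (inj₂ (inj₁ k≤v))) = inj₂ (inj₂ (inj₁ (≤-trans k≤v (degree-mono H⊆H′ v))))
  blocked-mono H⊆H′ {u} {v} (inj₂ (inj₂ (inj₂ w)))   = inj₂ (inj₂ (inj₂ (walk₃-mono H⊆H′ w)))

module Greedy {n : ℕ} (G : Graph n) (k : ℕ) where

  record State : Set where
    field
      graph    : Graph n
      ⊆G       : graph ⊆ G
      c4free   : C4Free graph
      degree≤k : ∀ v → degree graph v ≤ k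
  open State public

  initial : State
  initial = record
    { graph    = emptyGraph
    ; ⊆G       = emptyGraph-⊆ G
    ; c4free   = emptyGraph-C4Free
    ; degree≤k = λ v → ≤-trans (≤-reflexive (emptyGraph-degree v)) z≤n
    }

  Addable : State → Fin n → Fin n → Set
  Addable s u v = adj G u v ≡ true × degree (graph s) u < k × degree (graph s) v < k × ¬ Walk₃ (graph s) u v

  addable? : ∀ s u v → Dec (Addable s u v)
  addable? s u v = (adj G u v ≟ᴮ true) ×-dec (degree (graph s) u <? k) ×-dec (degree (graph s) v <? k)
                   ×-dec ¬? (walk₃? (graph s) u v)

  insert : ∀ s {u v} → Addable s u v → State
  insert s {u} {v} (uv , u<k , v<k , no-walk) = record
    { graph    = H⁺
    ; ⊆G       = H⁺⊆G
    ; c4free   = C4Free-H⁺ (c4free s) no-walk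
    ; degree≤k = λ x → bounded x (x ≟ u) (x ≟ v)
    }
    where
    open AddEdge (graph s) (adj⇒≢ G uv)
    H⁺⊆G : H⁺ ⊆ G
    H⁺⊆G = mk⊆ λ x y xy → new-or-old (adj-H⁺⁻ x y xy)
      where
      new-or-old : ∀ {x y} → adj (graph s) x y ≡ true ⊎ Joins x y → adj G x y ≡ true
      new-or-old (inj₁ old)                  = ⊆-adj (⊆G s) _ _ old
      new-or-old (inj₂ (inj₁ (refl , refl))) = uv
      new-or-old (inj₂ (inj₂ (refl , refl))) = trans (Graph.sym G v u) uv
    bounded : ∀ x → Dec (x ≡ u) → Dec (x ≡ v) → degree H⁺ x ≤ k
    bounded x (yes refl) _          = ≤-trans (degree-H⁺-≤ x) u<k
    bounded x (no _)     (yes refl) = ≤-trans (degree-H⁺-≤ x) v<k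
    bounded x (no x≢u)   (no x≢v)   = ≤-trans (degree-H⁺-other x x≢u x≢v) (degree≤k s x)

  consider : ∀ s u v → Dec (Addable s u v) → State
  consider s u v (yes addable) = insert s addable
  consider s u v (no _)        = s

  step : State → Fin n × Fin n → State
  step s (u , v) = consider s u v (addable? s u v)

  consider-grows : ∀ s u v a? → graph s ⊆ graph (consider s u v a?)
  consider-grows s u v (yes (uv , _)) = AddEdge.H⊆H⁺ (graph s) (adj⇒≢ G uv)
  consider-grows s u v (no _)         = ⊆-refl

  not-addable⇒blocked : ∀ s {u v} → adj G u v ≡ true → ¬ Addable s u v → Blocked k (graph s) u v
  not-addable⇒blocked s {u} {v} uv ¬addable
    with degree (graph s) u <? k | degree (graph s) v <? k | walk₃? (graph s) u v
  ... | no u≮k | _      | _        = inj₂ (inj₁ (≮⇒≥ u≮k))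
  ... | yes _  | no v≮k | _        = inj₂ (inj₂ (inj₁ (≮⇒≥ v≮k)))
  ... | yes _  | yes _  | yes walk = inj₂ (inj₂ (inj₂ walk))
  ... | yes u<k | yes v<k | no no-walk = ⊥-elim (¬addable (uv , u<k , v<k , no-walk))

  consider-blocks : ∀ s u v a? → adj G u v ≡ true → Blocked k (graph (consider s u v a?)) u v
  consider-blocks s u v (yes (uv , _)) _  = inj₁ (AddEdge.adj-H⁺-uv (graph s) (adj⇒≢ G uv))
  consider-blocks s u v (no ¬addable)  uv = not-addable⇒blocked s uv ¬addable

  foldl-grows : ∀ s ps → graph s ⊆ graph (foldl step s ps)
  foldl-grows s []             = ⊆-refl
  foldl-grows s ((u , v) ∷ ps) =
    ⊆-trans (consider-grows s u v (addable? s u v)) (foldl-grows (step s (u , v)) ps)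

  foldl-blocks : ∀ s ps {u v} → (u , v) ∈ ps → adj G u v ≡ true → Blocked k (graph (foldl step s ps)) u v
  foldl-blocks s ((u , v) ∷ ps) (here refl) uv =
    blocked-mono k (foldl-grows (step s (u , v)) ps) (consider-blocks s u v (addable? s u v) uv)
  foldl-blocks s (p ∷ ps) (there p∈ps) uv = foldl-blocks (step s p) ps p∈ps uv

  greedy : State
  greedy = foldl step initial (cartesianProduct (allFin n) (allFin n))

  greedy-blocks : ∀ u v → adj G u v ≡ true → Blocked k (graph greedy) u v
  greedy-blocks u v = foldl-blocks initial _ (∈-cartesianProduct⁺ (∈-allFin u) (∈-allFin v))

-- Charging the edges of G

module _ {n : ℕ} (H : Graph n) where

  ∑-neighbours-≤ : ∀ {f : Fin n → ℕ} {c} a → (∀ b → f b ≤ c) → ∑[ b < n ] (χ H a b * f b) ≤ c * degree H a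
  ∑-neighbours-≤ {f} {c} a f≤c = begin
    ∑[ b < n ] (χ H a b * f b)  ≤⟨ ∑-mono-≤ (λ b → *-monoʳ-≤ (χ H a b) (f≤c b)) ⟩
    ∑[ b < n ] (χ H a b * c)   ≡⟨ sum-cong-≗ (λ b → *-comm (χ H a b) c) ⟩
    ∑[ b < n ] (c * χ H a b)   ≡⟨ *-distribˡ-sum c (χ H a) ⟨
    c * ∑[ b < n ] χ H a b    ≡⟨ cong (c *_) (degree≡∑ H a) ⟨
    c * degree H a            ∎
    where open ≤-Reasoning

  paths₂ : Fin n → Fin n → ℕ
  paths₂ a v = ∑[ b < n ] (χ H a b * χ H b v)

  walks₃ : Fin n → Fin n → ℕ
  walks₃ u v = ∑[ a < n ] (χ H u a * paths₂ a v)

  walk₃⇒walks₃>0 : ∀ {u v} → Walk₃ H u v → 1 ≤ walks₃ u v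
  walk₃⇒walks₃>0 {u} {v} (a , b , ua , ab , bv) = begin
    1                             ≡⟨ cong₂ _*_ (cong 𝟙 ua) (cong₂ _*_ (cong 𝟙 ab) (cong 𝟙 bv)) ⟨
    χ H u a * (χ H a b * χ H b v) ≤⟨ *-monoʳ-≤ (χ H u a) (term≤∑ (λ b → χ H a b * χ H b v) b) ⟩
    χ H u a * paths₂ a v          ≤⟨ term≤∑ (λ a → χ H u a * paths₂ a v) a ⟩
    walks₃ u v                    ∎
    where open ≤-Reasoning

  ∑-walks₃-≤ : ∀ {k} → (∀ v → degree H v ≤ k) → ∀ u → ∑[ v < n ] walks₃ u v ≤ k * k * degree H u
  ∑-walks₃-≤ {k} degree≤k u = begin
    ∑[ v < n ] walks₃ u v                 ≡⟨ ∑-comm-scale (χ H u) paths₂ ⟩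
    ∑[ a < n ] (χ H u a * ∑[ v < n ] paths₂ a v) ≤⟨ ∑-neighbours-≤ u paths₂-from ⟩
    k * k * degree H u                    ∎
    where
    open ≤-Reasoning
    paths₂-from : ∀ a → ∑[ v < n ] paths₂ a v ≤ k * k
    paths₂-from a = begin
      ∑[ v < n ] paths₂ a v                   ≡⟨ ∑-comm-scale (χ H a) (χ H) ⟩
      ∑[ b < n ] (χ H a b * ∑[ v < n ] χ H b v) ≡⟨ sum-cong-≗ (λ b → cong (χ H a b *_) (degree≡∑ H b)) ⟨
      ∑[ b < n ] (χ H a b * degree H b)         ≤⟨ ∑-neighbours-≤ a degree≤k ⟩
      k * degree H a                          ≤⟨ *-monoʳ-≤ k (degree≤k a) ⟩
      k * k                                   ∎

blowup : ℕ → ℕ → ℕ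
blowup k Δ = k + 2 * Δ + k * k * k

1≤+₄ : ∀ {a b c d} → 1 ≤ a ⊎ 1 ≤ b ⊎ 1 ≤ c ⊎ 1 ≤ d → 1 ≤ a + b + c + d
1≤+₄ {a} {b} {c} {d} (inj₁ p)                = +-mono-≤ (+-mono-≤ (+-mono-≤ p (z≤n {b})) (z≤n {c})) (z≤n {d})
1≤+₄ {a} {b} {c} {d} (inj₂ (inj₁ p))         = +-mono-≤ (+-mono-≤ (+-mono-≤ (z≤n {a}) p) (z≤n {c})) (z≤n {d})
1≤+₄ {a} {b} {c} {d} (inj₂ (inj₂ (inj₁ p)))  = +-mono-≤ (+-mono-≤ (+-mono-≤ (z≤n {a}) (z≤n {b})) p) (z≤n {d})
1≤+₄ {a} {b} {c} {d} (inj₂ (inj₂ (inj₂ p)))  = +-mono-≤ (+-mono-≤ (+-mono-≤ (z≤n {a}) (z≤n {b})) (z≤n {c})) p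

module BlockingSubgraph {n : ℕ} (G H : Graph n) {k Δ : ℕ}
  (degree-H≤k : ∀ v → degree H v ≤ k) (degree-G≤Δ : ∀ v → degree G v ≤ Δ)
  (blocked : ∀ u v → adj G u v ≡ true → Blocked k H u v) where

  saturated : Fin n → ℕ
  saturated x = 𝟙 (does (k ≤? degree H x))

  saturated≡1 : ∀ {x} → k ≤ degree H x → saturated x ≡ 1
  saturated≡1 {x} k≤x = cong 𝟙 (dec-true (k ≤? degree H x) k≤x)

  k*saturated≤degree : ∀ x → k * saturated x ≤ degree H x
  k*saturated≤degree x = by-cases (k ≤? degree H x)
    where
    by-cases : (k≤? : Dec (k ≤ degree H x)) → k * 𝟙 (does k≤?) ≤ degree H x
    by-cases (yes k≤x) = ≤-trans (≤-reflexive (*-identityʳ k)) k≤x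
    by-cases (no _)    = ≤-trans (≤-reflexive (*-zeroʳ k)) z≤n

  edge-charge : ∀ u v → χ G u v ≤ χ H u v + saturated u * χ G u v + saturated v * χ G u v + walks₃ H u v
  edge-charge u v with adj G u v in uv
  ... | false = z≤n
  ... | true  = 1≤+₄ (charge (blocked u v uv))
    where
    charge : Blocked k H u v →
      1 ≤ χ H u v ⊎ 1 ≤ saturated u * 1 ⊎ 1 ≤ saturated v * 1 ⊎ 1 ≤ walks₃ H u v
    charge (inj₁ uvᴴ)                = inj₁ (≤-reflexive (sym (cong 𝟙 uvᴴ)))
    charge (inj₂ (inj₁ k≤u))         = inj₂ (inj₁ (≤-reflexive (sym (cong (_* 1) (saturated≡1 k≤u)))))
    charge (inj₂ (inj₂ (inj₁ k≤v)))  = inj₂ (inj₂ (inj₁ (≤-reflexive (sym (cong (_* 1) (saturated≡1 k≤v))))))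
    charge (inj₂ (inj₂ (inj₂ walk))) = inj₂ (inj₂ (inj₂ (walk₃⇒walks₃>0 H walk)))

  saturatedNeighbours : Fin n → ℕ
  saturatedNeighbours u = ∑[ v < n ] (saturated v * χ G u v)

  walks₃-from : Fin n → ℕ
  walks₃-from u = ∑[ v < n ] walks₃ H u v

  degree-charge : ∀ u →
    degree G u ≤ degree H u + saturated u * degree G u + saturatedNeighbours u + walks₃-from u
  degree-charge u = begin
    degree G u                   ≡⟨ degree≡∑ G u ⟩
    ∑[ v < n ] χ G u v           ≤⟨ ∑-mono-≤ (edge-charge u) ⟩
    ∑[ v < n ] (χ H u v + saturated u * χ G u v + saturated v * χ G u v + walks₃ H u v)
      ≡⟨ ∑-distrib-+₄ (χ H u) (λ v → saturated u * χ G u v) (λ v → saturated v * χ G u v) (walks₃ H u) ⟩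
    ∑[ v < n ] χ H u v + ∑[ v < n ] (saturated u * χ G u v) + saturatedNeighbours u + walks₃-from u
      ≡⟨ cong₂ (λ a b → a + b + saturatedNeighbours u + walks₃-from u) (sym (degree≡∑ H u)) own-term ⟩
    degree H u + saturated u * degree G u + saturatedNeighbours u + walks₃-from u ∎
    where
    open ≤-Reasoning
    own-term : ∑[ v < n ] (saturated u * χ G u v) ≡ saturated u * degree G u
    own-term = trans (sym (*-distribˡ-sum (saturated u) (χ G u))) (cong (saturated u *_) (sym (degree≡∑ G u)))

  saturated-charge : k * ∑[ u < n ] (saturated u * degree G u) ≤ Δ * ∑[ u < n ] degree H u
  saturated-charge = begin
    k * ∑[ u < n ] (saturated u * degree G u)   ≡⟨ *-distribˡ-sum k (λ u → saturated u * degree G u) ⟩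
    ∑[ u < n ] (k * (saturated u * degree G u)) ≤⟨ ∑-mono-≤ charge ⟩
    ∑[ u < n ] (Δ * degree H u)                 ≡⟨ *-distribˡ-sum Δ (degree H) ⟨
    Δ * ∑[ u < n ] degree H u                   ∎
    where
    open ≤-Reasoning
    charge : ∀ u → k * (saturated u * degree G u) ≤ Δ * degree H u
    charge u = begin
      k * (saturated u * degree G u) ≡⟨ *-assoc k (saturated u) (degree G u) ⟨
      k * saturated u * degree G u   ≤⟨ *-mono-≤ (k*saturated≤degree u) (degree-G≤Δ u) ⟩
      degree H u * Δ                 ≡⟨ *-comm (degree H u) Δ ⟩
      Δ * degree H u                 ∎

  transposed-charge : ∑[ u < n ] saturatedNeighbours u ≡ ∑[ v < n ] (saturated v * degree G v)
  transposed-charge = begin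
    ∑[ u < n ] saturatedNeighbours u              ≡⟨ ∑-comm-scale saturated (λ v u → χ G u v) ⟩
    ∑[ v < n ] (saturated v * ∑[ u < n ] χ G u v)
      ≡⟨ sum-cong-≗ (λ v → cong (saturated v *_) (sum-cong-≗ (λ u → χ-sym G u v))) ⟩
    ∑[ v < n ] (saturated v * ∑[ u < n ] χ G v u) ≡⟨ sum-cong-≗ (λ v → cong (saturated v *_) (degree≡∑ G v)) ⟨
    ∑[ v < n ] (saturated v * degree G v)         ∎
    where open ≡-Reasoning

  walk-charge : ∑[ u < n ] walks₃-from u ≤ k * k * ∑[ u < n ] degree H u
  walk-charge = begin
    ∑[ u < n ] walks₃-from u           ≤⟨ ∑-mono-≤ (∑-walks₃-≤ H degree-H≤k) ⟩
    ∑[ u < n ] (k * k * degree H u)    ≡⟨ *-distribˡ-sum (k * k) (degree H) ⟨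
    k * k * ∑[ u < n ] degree H u      ∎
    where open ≤-Reasoning

  degree-sum-≤ : k * ∑[ u < n ] degree G u ≤ ∑[ u < n ] degree H u * blowup k Δ
  degree-sum-≤ = begin
    k * ∑[ u < n ] degree G u                        ≤⟨ *-monoʳ-≤ k (∑-mono-≤ degree-charge) ⟩
    k * ∑[ u < n ] (degree H u + saturated u * degree G u + saturatedNeighbours u + walks₃-from u)
      ≡⟨ cong (k *_) (∑-distrib-+₄ (degree H) (λ u → saturated u * degree G u) saturatedNeighbours walks₃-from) ⟩
    k * (DH + A + ∑[ u < n ] saturatedNeighbours u + W) ≡⟨ cong (λ b → k * (DH + A + b + W)) transposed-charge ⟩
    k * (DH + A + A + W)                             ≡⟨ distrib k DH A W ⟩
    k * DH + k * A + k * A + k * W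
      ≤⟨ +-mono-≤ (+-mono-≤ (+-monoʳ-≤ (k * DH) saturated-charge) saturated-charge) (*-monoʳ-≤ k walk-charge) ⟩
    k * DH + Δ * DH + Δ * DH + k * (k * k * DH)      ≡⟨ collect k Δ DH ⟩
    DH * blowup k Δ                                  ∎
    where
    open ≤-Reasoning
    DH A W : ℕ
    DH = ∑[ u < n ] degree H u
    A  = ∑[ u < n ] (saturated u * degree G u)
    W  = ∑[ u < n ] walks₃-from u
    distrib : ∀ k d a w → k * (d + a + a + w) ≡ k * d + k * a + k * a + k * w
    distrib = solve-∀
    collect : ∀ k Δ d → k * d + Δ * d + Δ * d + k * (k * k * d) ≡ d * (k + 2 * Δ + k * k * k)
    collect = solve-∀

-- Choosing k

^-distrib-* : ∀ a b n → (a * b) ^ n ≡ a ^ n * b ^ n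
^-distrib-* a b zero    = refl
^-distrib-* a b (suc n) = trans (cong (a * b *_) (^-distrib-* a b n)) (interchange a b (a ^ n) (b ^ n))
  where
  interchange : ∀ a b x y → a * b * (x * y) ≡ a * x * (b * y)
  interchange = solve-∀

Admissible : ℕ → ℕ → Set
Admissible k Δ = 1 ≤ k × blowup k Δ ^ 4 ≤ 256 * k ^ 4 * Δ ^ 3

admissible? : ∀ k Δ → Dec (Admissible k Δ)
admissible? k Δ = (1 ≤? k) ×-dec (blowup k Δ ^ 4 ≤? 256 * k ^ 4 * Δ ^ 3)

-- Below 27 the cube root is too small, but k = 1 or k = 2 works.
admissible-small : ∀ {Δ} → Δ < 27 → 1 ≤ Δ → ∃ λ k → k < 3 × Admissible k Δ
admissible-small = toWitness {a? = allUpTo? (λ Δ → (1 ≤? Δ) →-dec anyUpTo? (λ k → admissible? k Δ) 3) 27} _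

cube : ℕ → ℕ
cube r = r * r * r

cube-mono-≤ : ∀ {a b} → a ≤ b → cube a ≤ cube b
cube-mono-≤ a≤b = *-mono-≤ (*-mono-≤ a≤b a≤b) a≤b

cube-mono-< : ∀ {a b} → a < b → cube a < cube b
cube-mono-< a<b = *-mono-< (*-mono-< a<b a<b) a<b

cubeRoot : ∀ Δ → ∃ λ r → cube r ≤ Δ × Δ < cube (suc r)
cubeRoot zero = 0 , z≤n , s≤s z≤n
cubeRoot (suc Δ) with cubeRoot Δ
... | r , r³≤Δ , Δ<[r+1]³ with cube (suc r) ≤? suc Δ
...   | yes [r+1]³≤1+Δ = suc r , [r+1]³≤1+Δ , ≤-<-trans Δ<[r+1]³ (cube-mono-< (n<1+n (suc r)))
...   | no  [r+1]³≰1+Δ = r , m≤n⇒m≤1+n r³≤Δ , ≰⇒> [r+1]³≰1+Δ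

[r+1]³≤r⁴ : ∀ {r} → 3 ≤ r → cube (suc r) ≤ r ^ 4
[r+1]³≤r⁴ {suc (suc (suc j))} (s≤s (s≤s (s≤s _))) = ≤-trans (m≤m+n _ _) (≤-reflexive (sym (expand j)))
  where
  expand : ∀ j → (3 + j) * ((3 + j) * ((3 + j) * ((3 + j) * 1)))
               ≡ (4 + j) * (4 + j) * (4 + j) + (j * j * j * j + 11 * (j * j * j) + 42 * (j * j) + 60 * j + 17)
  expand = solve-∀

-- k = ⌊Δ^(1/3)⌋ satisfies k³ ≤ Δ < (k+1)³ ≤ k⁴ once k ≥ 3.
admissible-large : ∀ {Δ} → 27 ≤ Δ → ∃ λ k → Admissible k Δ
admissible-large {Δ} 27≤Δ with cubeRoot Δ
... | r , r³≤Δ , Δ<[r+1]³ = r , ≤-trans (s≤s z≤n) 3≤r , bound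
  where
  3≤r : 3 ≤ r
  3≤r = ≮⇒≥ λ r<3 → <⇒≱ Δ<[r+1]³ (≤-trans (cube-mono-≤ r<3) 27≤Δ)
  r≤r³ : r ≤ cube r
  r≤r³ = ≤-trans (m≤m*n r r) (m≤m*n (r * r) r)
    where instance _ = >-nonZero (≤-trans (s≤s z≤n) 3≤r)
  blowup≤4Δ : blowup r Δ ≤ 4 * Δ
  blowup≤4Δ = ≤-trans (+-mono-≤ (+-monoˡ-≤ (2 * Δ) (≤-trans r≤r³ r³≤Δ)) r³≤Δ) (≤-reflexive (four Δ))
    where
    four : ∀ Δ → Δ + 2 * Δ + Δ ≡ 4 * Δ
    four = solve-∀
  bound : blowup r Δ ^ 4 ≤ 256 * r ^ 4 * Δ ^ 3
  bound = begin
    blowup r Δ ^ 4    ≤⟨ ^-monoˡ-≤ 4 blowup≤4Δ ⟩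
    (4 * Δ) ^ 4       ≡⟨ ^-distrib-* 4 Δ 4 ⟩
    256 * (Δ * Δ ^ 3) ≤⟨ *-monoʳ-≤ 256 (*-monoˡ-≤ (Δ ^ 3) (≤-trans (<⇒≤ Δ<[r+1]³) ([r+1]³≤r⁴ 3≤r))) ⟩
    256 * (r ^ 4 * Δ ^ 3) ≡⟨ *-assoc 256 (r ^ 4) (Δ ^ 3) ⟨
    256 * r ^ 4 * Δ ^ 3 ∎
    where open ≤-Reasoning

admissible : ∀ Δ → 1 ≤ Δ → ∃ λ k → Admissible k Δ
admissible Δ 1≤Δ with Δ <? 27
... | yes Δ<27 = let k , _ , adm = admissible-small Δ<27 1≤Δ in k , adm
... | no  Δ≮27 = admissible-large (≮⇒≥ Δ≮27)

degree-ratio : ∀ {k} a b M Δ → 1 ≤ k → k * a ≤ b * M → M ^ 4 ≤ 256 * k ^ 4 * Δ ^ 3 → a ^ 4 ≤ (4 * b) ^ 4 * Δ ^ 3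
degree-ratio {k} a b M Δ 1≤k ka≤bM M⁴≤ = *-cancelˡ-≤ (k ^ 4) (begin
  k ^ 4 * a ^ 4               ≡⟨ ^-distrib-* k a 4 ⟨
  (k * a) ^ 4                 ≤⟨ ^-monoˡ-≤ 4 ka≤bM ⟩
  (b * M) ^ 4                 ≡⟨ ^-distrib-* b M 4 ⟩
  b ^ 4 * M ^ 4               ≤⟨ *-monoʳ-≤ (b ^ 4) M⁴≤ ⟩
  b ^ 4 * (256 * k ^ 4 * Δ ^ 3) ≡⟨ swap (b ^ 4) (k ^ 4) (Δ ^ 3) ⟩
  k ^ 4 * (256 * b ^ 4 * Δ ^ 3) ≡⟨ cong (λ x → k ^ 4 * (x * Δ ^ 3)) (^-distrib-* 4 b 4) ⟨
  k ^ 4 * ((4 * b) ^ 4 * Δ ^ 3) ∎)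
  where
  open ≤-Reasoning
  instance _ = m^n≢0 k 4 {{>-nonZero 1≤k}}
  swap : ∀ B K D → B * (256 * K * D) ≡ K * (256 * B * D)
  swap = solve-∀

scale-^4 : ∀ a c D m → a ^ 4 ≤ c ^ 4 * D → (a * m) ^ 4 ≤ (c * m) ^ 4 * D
scale-^4 a c D m a⁴≤ = begin
  (a * m) ^ 4       ≡⟨ ^-distrib-* a m 4 ⟩
  a ^ 4 * m ^ 4     ≤⟨ *-monoˡ-≤ (m ^ 4) a⁴≤ ⟩
  c ^ 4 * D * m ^ 4 ≡⟨ swap (c ^ 4) D (m ^ 4) ⟩
  c ^ 4 * m ^ 4 * D ≡⟨ cong (_* D) (^-distrib-* c m 4) ⟨
  (c * m) ^ 4 * D   ∎
  where
  open ≤-Reasoning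
  swap : ∀ C D M → C * D * M ≡ C * M * D
  swap = solve-∀

lemma3p3 : ∀ {n} (G : Graph n) (Δ : ℕ) → 1 ≤ n → IsMaxDegree G Δ →
    Δ ^ 3 * n ^ 4 ≤ (2 * edges G) ^ 4 →
    ∃ λ m → Σ (Graph m) λ H → IsSubgraph H G × 1 ≤ m × C4Free H ×
      (2 * edges G * m) ^ 4 ≤ (4 * (2 * edges H) * n) ^ 4 * Δ ^ 3
lemma3p3 {n} G zero n≥1 (degree≤0 , _) _ =
  n , emptyGraph , ⊆⇒IsSubgraph (emptyGraph-⊆ G) , n≥1 , emptyGraph-C4Free , no-edges
  where
  no-edges : (2 * edges G * n) ^ 4 ≤ (4 * (2 * edges (emptyGraph {n})) * n) ^ 4 * 0 ^ 3
  no-edges rewrite edges≡0 G degree≤0 = z≤n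
lemma3p3 {n} G Δ@(suc _) n≥1 (degree≤Δ , _) _ with admissible Δ (s≤s z≤n)
... | k , 1≤k , blowup⁴≤ =
  n , graph H , ⊆⇒IsSubgraph (⊆G H) , n≥1 , c4free H , scale-^4 dG (4 * dH) (Δ ^ 3) n ratio
  where
  open Greedy G k
  H = greedy
  dG = 2 * edges G
  dH = 2 * edges (graph H)
  charged : k * dG ≤ dH * blowup k Δ
  charged = subst₂ (λ x y → k * x ≤ y * blowup k Δ) (handshake G) (handshake (graph H))
    (BlockingSubgraph.degree-sum-≤ G (graph H) (degree≤k H) degree≤Δ greedy-blocks)
  ratio : dG ^ 4 ≤ (4 * dH) ^ 4 * Δ ^ 3
  ratio = degree-ratio dG dH (blowup k Δ) Δ 1≤k charged blowup⁴≤
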